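{- Let $\Gamma$ be a context and $l_1,\ldots,l_k$ constructor terms with $\Gamma\vdash_{\min}l_i:\mathbf B(p_i)$ for each $i$. Suppose erased terms $t_1,\ldots,t_k$ match $l_1,\ldots,l_k$, i.e. there is a substitution $\sigma$ with $|l_i|\sigma=t_i$ for all $i$. Then $\mathrm{match}_{\mathcal P}(t_1,\ldots,t_k;p_1,\ldots,p_k)$ is defined.
   Context: Patterns $p::=\alpha\mid\mathsf{leaf}\mid\mathsf{node}(p,q)\mid\_\mid\bot$; minimal patterns: $p::=\alpha\mid\mathsf{leaf}\mid\mathsf{node}(p,q)$. Types include $\mathbf B(p)$. Constructor terms: $l::=x\mid\mathsf{Leaf}\mid\mathsf{Node}\,p\,q\,l_1\,l_2$; erasure $|\cdot|$ removes pattern arguments ($|x|=x$, $|\mathsf{Leaf}|=\mathsf{Leaf}$, $|\mathsf{Node}\,p\,q\,l_1\,l_2|=\mathsf{Node}\,|l_1|\,|l_2|$). Contexts: lists $x:T$ with each variable at most once. Minimal typing: $\Gamma,x{:}\mathbf B(\alpha),\Gamma'\vdash_{\min}x:\mathbf B(\alpha)$ if $\alpha$ does not occur in $\Gamma,\Gamma'$; $\Gamma\vdash_{\min}\mathsf{Leaf}:\mathbf B(\mathsf{leaf})$; from $\Gamma\vdash_{\min}l_j:\mathbf B(p_j)$ ($j=1,2$) infer $\Gamma\vdash_{\min}\mathsf{Node}\,p_1p_2l_1l_2:\mathbf B(\mathsf{node}(p_1,p_2))$. Erased terms $t::=x\mid f\mid\lambda x.t\mid t\,u\mid\mathsf{Leaf}\mid\mathsf{Node}$,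 with normal forms relative to a fixed reduction; for a normal form $t$: $\mathrm{pat}(t)=\bot$ if $t$ is neutral (not of the form $\lambda x.t'$, $\mathsf{Node}\,t_1t_2$, $\mathsf{Leaf}$), $\mathrm{pat}(\mathsf{Leaf})=\mathsf{leaf}$, $\mathrm{pat}(\mathsf{Node}\,t\,u)=\mathsf{node}(\mathrm{pat}(t),\mathrm{pat}(u))$, $\mathrm{pat}(t)=\_$ otherwise. The partial function $\mathrm{match}_{\mathcal P}(t_1,\ldots,t_n;p_1,\ldots,p_n)$ (erased terms, minimal patterns), returning a pattern valuation: if all $p_i$ are variables $\alpha_i$ and $t_i=t_j$ whenever $\alpha_i=\alpha_j$, it is the valuation $\alpha_i\mapsto\{\mathrm{pat}(v)\mid v$ normal form of $t_i\}$; if some $p_i=\mathsf{node}(q_1,q_2)$ and $t_i=\mathsf{Node}\,u_1\,u_2$, it equals $\mathrm{match}_{\mathcal P}$ of the lists with $t_i$ replaced by $u_1,u_2$ and $p_i$ by $q_1,q_2$; if some $p_i=\mathsf{leaf}$ and $t_i=\mathsf{Leaf}$, it equals $\mathrm{match}_{\mathcal P}$ of the lists with the $i$-th entries removed; otherwise it is undefined. -}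

module Defs where

open import Level using (0ℓ)
open import Data.Nat using (ℕ; _≡ᵇ_)
open import Data.Bool using (if_then_else_)
open import Data.Empty using (⊥)
open import Data.Product using (Σ; ∃; _×_; _,_; proj₁; proj₂)
open import Data.Sum using (_⊎_)
open import Data.List using (List; []; _∷_; _++_; map; length)
open import Data.List.Membership.Propositional using (_∈_)
open import Relation.Nullary using (¬_)
open import Relation.Binary.PropositionalEquality using (_≡_)
open import Relation.Binary.Construct.Closure.ReflexiveTransitive using (Star)

Var : Set
Var = ℕ

FSym : Set
FSym = ℕ

PVar : Set
PVar = ℕ

data Pat : Set where
  pvar : PVar → Pat
  leaf : Pat
  node : Pat → Pat → Pat
  wild : Pat
  bot  : Pat

OccP : PVar → Pat → Set
OccP α (pvar β)   = α ≡ β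
OccP α leaf       = ⊥
OccP α (node p q) = OccP α p ⊎ OccP α q
OccP α wild       = ⊥
OccP α bot        = ⊥

data Ty : Set where
  B   : Pat → Ty
  _⇒_ : Ty → Ty → Ty

OccT : PVar → Ty → Set
OccT α (B p)   = OccP α p
OccT α (T ⇒ U) = OccT α T ⊎ OccT α U

-- Contexts: lists of declarations x : T (uniqueness imposed in the theorem).
Ctx : Set
Ctx = List (Var × Ty)

OccCtx : PVar → Ctx → Set
OccCtx α Γ = ∃ λ d → d ∈ Γ × OccT α (proj₂ d)

data CTerm : Set where
  cvar  : Var → CTerm
  cLeaf : CTerm
  cNode : Pat → Pat → CTerm → CTerm → CTerm

data Term : Set where
  var  : Var → Term
  fun  : FSym → Term
  lam  : Var → Term → Term
  app  : Term → Term → Term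
  Leaf : Term
  Node : Term

erase : CTerm → Term
erase (cvar x)          = var x
erase cLeaf             = Leaf
erase (cNode p q l₁ l₂) = app (app Node (erase l₁)) (erase l₂)

-- Only ever applied to erasures of constructor terms,
-- which contain no binders; the λ case is included for totality
-- (the binder shadows σ; capture is irrelevant on binder-free terms).
Subst : Set
Subst = Var → Term

_[_] : Term → Subst → Term
var x   [ σ ] = σ x
fun f   [ σ ] = fun f
lam x t [ σ ] = lam x (t [ (λ y → if y ≡ᵇ x then var y else σ y) ])
app t u [ σ ] = app (t [ σ ]) (u [ σ ])
Leaf    [ σ ] = Leaf
Node    [ σ ] = Node

data _⊢min_∶B_ : Ctx → CTerm → Pat → Set where
  tvar  : ∀ {Γ Γ′ x α} → ¬ OccCtx α (Γ ++ Γ′) →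
          (Γ ++ (x , B (pvar α)) ∷ Γ′) ⊢min cvar x ∶B pvar α
  tLeaf : ∀ {Γ} → Γ ⊢min cLeaf ∶B leaf
  tNode : ∀ {Γ p₁ p₂ l₁ l₂} → Γ ⊢min l₁ ∶B p₁ → Γ ⊢min l₂ ∶B p₂ →
          Γ ⊢min cNode p₁ p₂ l₁ l₂ ∶B node p₁ p₂

pat : Term → Pat
pat (lam x t)            = wild
pat Leaf                 = leaf
pat (app (app Node t) u) = node (pat t) (pat u)
pat _                    = bot

module Reduction (_⟶_ : Term → Term → Set) where

  Normal : Term → Set
  Normal t = ∀ u → ¬ (t ⟶ u)

  NormalFormOf : Term → Term → Set
  NormalFormOf t v = Star _⟶_ t v × Normal v

  Valuation : Set₁
  Valuation = PVar → Pat → Set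

  baseVal : List (Term × PVar) → Valuation
  baseVal zs α q = ∃ λ t → (t , α) ∈ zs × ∃ λ v → NormalFormOf t v × pat v ≡ q

  -- match_P(t₁..tₙ ; p₁..pₙ) = ρ   (as the graph of the partial function)
  data MatchP : List Term → List Pat → Valuation → Set₁ where
    mVars : ∀ (zs : List (Term × PVar)) →
            (∀ {t α t′ α′} → (t , α) ∈ zs → (t′ , α′) ∈ zs → α ≡ α′ → t ≡ t′) →
            MatchP (map proj₁ zs) (map (λ z → pvar (proj₂ z)) zs) (baseVal zs)
    mNode : ∀ {ts₁ ts₂ ps₁ ps₂ u₁ u₂ q₁ q₂ ρ} → length ts₁ ≡ length ps₁ →
            MatchP (ts₁ ++ u₁ ∷ u₂ ∷ ts₂) (ps₁ ++ q₁ ∷ q₂ ∷ ps₂) ρ →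
            MatchP (ts₁ ++ app (app Node u₁) u₂ ∷ ts₂) (ps₁ ++ node q₁ q₂ ∷ ps₂) ρ
    mLeaf : ∀ {ts₁ ts₂ ps₁ ps₂ ρ} → length ts₁ ≡ length ps₁ →
            MatchP (ts₁ ++ ts₂) (ps₁ ++ ps₂) ρ →
            MatchP (ts₁ ++ Leaf ∷ ts₂) (ps₁ ++ leaf ∷ ps₂) ρ

  MatchDefined : List Term → List Pat → Set₁
  MatchDefined ts ps = Σ Valuation (MatchP ts ps)

-- Decompose match_P along the constructor skeleton of the l_i: the term |l|σ
-- has exactly the Leaf/Node shape of its minimal type p, so the leaf and node
-- rules of match_P apply until only pattern variables remain, each facing some
-- σ x.  The variable rule is then applicable because its side condition (α
-- fresh in the rest of Γ) makes α the type of exactly one x, so two entries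
-- carrying the same α carry the same term σ x.
module Submission where

open import Defs
open import Data.Empty using (⊥-elim)
open import Data.Product using (Σ; ∃; _×_; _,_; proj₁; proj₂)
open import Data.Sum using (inj₁; inj₂)
open import Data.List using (List; []; _∷_; _++_; map; length)
open import Data.List.Properties using (map-++; ++-assoc; ++-identityʳ; length-map)
open import Data.List.Relation.Unary.All using (All; _∷_; []; lookup)
open import Data.List.Relation.Unary.All.Properties using (++⁺)
open import Data.List.Relation.Unary.Any using (here; there)
open import Data.List.Relation.Unary.Unique.Propositional using (Unique)
open import Data.List.Relation.Binary.Pointwise using (Pointwise; []; _∷_)
open import Data.List.Membership.Propositional using (_∈_)
open import Data.List.Membership.Propositional.Properties using (∈-++⁻; ∈-++⁺ˡ; ∈-++⁺ʳ)
open import Relation.Nullary using (¬_)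
open import Relation.Binary.PropositionalEquality
  using (_≡_; refl; sym; trans; cong; subst; subst₂)

FreshlyDeclared : Ctx → Var → PVar → Set
FreshlyDeclared Γ x α = Σ Ctx λ Γ₁ → Σ Ctx λ Γ₂ →
  Γ ≡ Γ₁ ++ (x , B (pvar α)) ∷ Γ₂ × ¬ OccCtx α (Γ₁ ++ Γ₂)

⊢min-cvar-inv : ∀ {Γ x p} → Γ ⊢min cvar x ∶B p →
                ∃ λ α → p ≡ pvar α × FreshlyDeclared Γ x α
⊢min-cvar-inv (tvar {Γ} {Γ′} {x} {α} fresh) = α , refl , Γ , Γ′ , refl , fresh

freshlyDeclared-unique : ∀ {Γ x x′ α} → FreshlyDeclared Γ x α →
                         FreshlyDeclared Γ x′ α → x ≡ x′
freshlyDeclared-unique {x′ = x′} {α} (Γ₁ , Γ₂ , refl , fresh) (Γ₁′ , _ , Γ≡ , _)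
  with ∈-++⁻ Γ₁ (subst ((x′ , B (pvar α)) ∈_) (sym Γ≡) (∈-++⁺ʳ Γ₁′ (here refl)))
... | inj₁ x′∈Γ₁         = ⊥-elim (fresh (_ , ∈-++⁺ˡ x′∈Γ₁ , refl))
... | inj₂ (here refl)   = refl
... | inj₂ (there x′∈Γ₂) = ⊥-elim (fresh (_ , ∈-++⁺ʳ Γ₁ x′∈Γ₂ , refl))

module _ (_⟶_ : Term → Term → Set) (Γ : Ctx) (σ : Subst) where
  open Reduction _⟶_

  -- The shape of an entry of match_P once it is fully decomposed.
  VarInstance : Term × PVar → Set
  VarInstance (t , α) = ∃ λ x → t ≡ σ x × FreshlyDeclared Γ x α

  terms : List (Term × PVar) → List Term
  terms = map proj₁

  patVars : List (Term × PVar) → List Pat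
  patVars = map (λ z → pvar (proj₂ z))

  length-terms≡length-patVars : ∀ zs → length (terms zs) ≡ length (patVars zs)
  length-terms≡length-patVars zs = trans (length-map proj₁ zs) (sym (length-map _ zs))

  matchP-varInstances : ∀ zs → All VarInstance zs →
                        MatchP (terms zs) (patVars zs) (baseVal zs)
  matchP-varInstances zs instances = mVars zs consistent
    where
    consistent : ∀ {t α t′ α′} → (t , α) ∈ zs → (t′ , α′) ∈ zs → α ≡ α′ → t ≡ t′
    consistent t∈ t′∈ refl with lookup instances t∈ | lookup instances t′∈
    ... | _ , refl , decl | _ , refl , decl′ = cong σ (freshlyDeclared-unique decl decl′)

  matchDefined-snoc : ∀ zs t α ts ps →
    MatchDefined (terms (zs ++ (t , α) ∷ []) ++ ts) (patVars (zs ++ (t , α) ∷ []) ++ ps) →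
    MatchDefined (terms zs ++ t ∷ ts) (patVars zs ++ pvar α ∷ ps)
  matchDefined-snoc zs t α ts ps = subst₂ MatchDefined
    (trans (cong (_++ ts) (map-++ proj₁ zs _)) (++-assoc (terms zs) _ ts))
    (trans (cong (_++ ps) (map-++ _ zs _)) (++-assoc (patVars zs) _ ps))

  -- Continuation-passing form: the hypothesis on the rest of the lists is
  -- quantified over every prefix, so that decomposing a Node (which leaves its
  -- second argument pending in front of ts) stays structurally recursive.
  matchDefined-⊢min : ∀ zs l p {ts ps} → Γ ⊢min l ∶B p → All VarInstance zs →
    (∀ zs′ → All VarInstance zs′ → MatchDefined (terms zs′ ++ ts) (patVars zs′ ++ ps)) →
    MatchDefined (terms zs ++ erase l [ σ ] ∷ ts) (patVars zs ++ p ∷ ps)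
  matchDefined-⊢min zs (cvar x) p {ts} {ps} ⊢x instances rest
    with ⊢min-cvar-inv ⊢x
  ... | α , refl , decl = matchDefined-snoc zs (σ x) α ts ps
          (rest (zs ++ (σ x , α) ∷ []) (++⁺ instances ((x , refl , decl) ∷ [])))
  matchDefined-⊢min zs cLeaf .leaf tLeaf instances rest
    with rest zs instances
  ... | ρ , m = ρ , mLeaf (length-terms≡length-patVars zs) m
  matchDefined-⊢min zs (cNode p₁ p₂ l₁ l₂) .(node p₁ p₂) (tNode ⊢l₁ ⊢l₂) instances rest
    with matchDefined-⊢min zs l₁ p₁ ⊢l₁ instances
           (λ zs′ instances′ → matchDefined-⊢min zs′ l₂ p₂ ⊢l₂ instances′ rest)
  ... | ρ , m = ρ , mNode (length-terms≡length-patVars zs) m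

  matchDefined-⊢min* : ∀ zs ls ps ts → Pointwise (λ l p → Γ ⊢min l ∶B p) ls ps →
    Pointwise (λ l t → erase l [ σ ] ≡ t) ls ts → All VarInstance zs →
    MatchDefined (terms zs ++ ts) (patVars zs ++ ps)
  matchDefined-⊢min* zs [] [] [] [] [] instances =
    baseVal zs , subst₂ (λ ts ps → MatchP ts ps (baseVal zs))
      (sym (++-identityʳ (terms zs))) (sym (++-identityʳ (patVars zs)))
      (matchP-varInstances zs instances)
  matchDefined-⊢min* zs (l ∷ ls) (p ∷ ps) (_ ∷ ts) (⊢l ∷ ⊢ls) (refl ∷ ≡ts) instances =
    matchDefined-⊢min zs l p ⊢l instances
      (λ zs′ instances′ → matchDefined-⊢min* zs′ ls ps ts ⊢ls ≡ts instances′)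

mainTheorem10 : (_⟶_ : Term → Term → Set) (Γ : Ctx) → Unique (map proj₁ Γ) →
    (ls : List CTerm) (ps : List Pat) → Pointwise (λ l p → Γ ⊢min l ∶B p) ls ps →
    (ts : List Term) (σ : Subst) → Pointwise (λ l t → erase l [ σ ] ≡ t) ls ts →
    Reduction.MatchDefined _⟶_ ts ps
mainTheorem10 _⟶_ Γ _ ls ps ⊢ls ts σ ≡ts =
  matchDefined-⊢min* _⟶_ Γ σ [] ls ps ts ⊢ls ≡ts []
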